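{- Let $f\colon\mathbb F_2^n\to\{+1,-1\}$ be non-linear and at most $1/10$-far from linear. Then $D^{\rightarrow}_{1/200}(f^+)>1$.
   Context: $\chi_S(x)=(-1)^{S\cdot x}$ for $S\in\mathbb F_2^n$. $f$ is non-linear if for every $S\in\mathbb F_2^n$ there is $x$ with $f(x)\ne\chi_S(x)$. $f$ is $\epsilon$-far from linear if $\max_{S\in\mathbb F_2^n}\Pr_{x\sim U(\mathbb F_2^n)}[\chi_S(x)=f(x)]=1-\epsilon$; "at most $1/10$-far" means this $\epsilon\le1/10$. $f^+(x,y)=f(x+y)$. For a distribution $\mu$ on $\mathbb F_2^n\times\mathbb F_2^n$ and $F\colon\mathbb F_2^n\times\mathbb F_2^n\to\{\pm1\}$, $D^{\rightarrow,\mu}_\delta(F)$ is the smallest $t$ such that there are $M\colon\mathbb F_2^n\to\{0,1\}^t$ (Alice's message) and $h\colon\{0,1\}^t\times\mathbb F_2^n\to\{\pm1\}$ with $\Pr_{(x,y)\sim\mu}[h(M(x),y)=F(x,y)]\ge1-\delta$; $D^{\rightarrow}_\delta(F)=\sup_\mu D^{\rightarrow,\mu}_\delta(F)$ (which equals the randomized public-coin one-way communication complexity with error $\delta$). -}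

module Defs where

open import Data.Bool using (Bool; true; false; _xor_; _∧_; if_then_else_)
open import Data.Nat using (ℕ; zero; suc; _+_; _*_; _^_; _≤_; _<_)
open import Data.List using (List; []; _∷_; map; concatMap)
open import Data.Nat.ListAction using (sum)
open import Data.Vec using (Vec; []; _∷_; zipWith; foldr′)
open import Relation.Binary.PropositionalEquality using (_≡_; _≢_)
open import Data.Product using (Σ; _×_; _,_; proj₁; proj₂)

-- Conventions: F₂ = Bool (false = 0, true = 1, addition = xor).
-- A ±1 value is encoded as a Bool via  +1 ↦ false,  -1 ↦ true
-- (i.e. b ↦ (-1)^b), so f : F₂ⁿ → {±1} is a function  Vec Bool n → Bool.

F2^ : ℕ → Set
F2^ n = Vec Bool n

_⊕_ : ∀ {n} → F2^ n → F2^ n → F2^ n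
_⊕_ = zipWith _xor_

dot : ∀ {n} → F2^ n → F2^ n → Bool
dot S x = foldr′ _xor_ false (zipWith _∧_ S x)

-- Character χ_S(x) = (-1)^{S·x}, in the ±1-as-Bool encoding
χ : ∀ {n} → F2^ n → F2^ n → Bool
χ S x = dot S x

allVecs : (n : ℕ) → List (F2^ n)
allVecs zero = [] ∷ []
allVecs (suc n) = concatMap (λ v → (false ∷ v) ∷ (true ∷ v) ∷ []) (allVecs n)

allPairs : (n : ℕ) → List (F2^ n × F2^ n)
allPairs n = concatMap (λ x → map (λ y → (x , y)) (allVecs n)) (allVecs n)

[_] : Bool → ℕ
[ true ] = 1
[ false ] = 0

eqB : Bool → Bool → Bool
eqB a b = if a xor b then false else true

-- number of x ∈ F₂ⁿ with χ_S(x) = f(x);  Pr_x[χ_S(x) = f(x)] = agree / 2ⁿ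
agree : ∀ {n} → (F2^ n → Bool) → F2^ n → ℕ
agree {n} f S = sum (map (λ x → [ eqB (χ S x) (f x) ]) (allVecs n))

NonLinear : ∀ {n} → (F2^ n → Bool) → Set
NonLinear {n} f = (S : F2^ n) → Σ (F2^ n) λ x → f x ≢ χ S x

-- f is at most 1/10-far from linear:
--   ε = 1 - max_S Pr[χ_S = f] ≤ 1/10  ⇔  ∃ S. Pr[χ_S = f] ≥ 9/10
--   ⇔ ∃ S. 10 · #{x : χ_S x = f x} ≥ 9 · 2ⁿ
AtMostTenthFar : ∀ {n} → (F2^ n → Bool) → Set
AtMostTenthFar {n} f = Σ (F2^ n) λ S → 9 * 2 ^ n ≤ 10 * agree f S

_⁺ : ∀ {n} → (F2^ n → Bool) → F2^ n → F2^ n → Bool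
(f ⁺) x y = f (x ⊕ y)

-- A distribution μ on F₂ⁿ × F₂ⁿ with rational probabilities, given by
-- natural-number weights w with positive total: μ(x,y) = w(x,y) / Σ w.
record Dist (n : ℕ) : Set where
  field
    w     : F2^ n → F2^ n → ℕ
open Dist public

total : ∀ {n} → Dist n → ℕ
total {n} μ = sum (map (λ p → w μ (proj₁ p) (proj₂ p)) (allPairs n))

-- μ-weight of the pairs on which a one-way protocol (M, h) with t-bit
-- messages computes F correctly; Pr_μ[h(M x, y) = F x y] = correctW / total
correctW : ∀ {n t} → Dist n → (F2^ n → F2^ n → Bool)
         → (F2^ n → Vec Bool t) → (Vec Bool t → F2^ n → Bool) → ℕ
correctW {n} μ F M h =
  sum (map (λ p → w μ (proj₁ p) (proj₂ p) * [ eqB (h (M (proj₁ p)) (proj₂ p)) (F (proj₁ p) (proj₂ p)) ])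
           (allPairs n))

-- D^{→,μ}_{1/200}(F) > 1 : no protocol with t ≤ 1 bits has
-- Pr_μ[correct] ≥ 1 - 1/200, i.e. for all such protocols
-- 200 · correctW < 199 · total.
DistCCGreaterThan1 : ∀ {n} → Dist n → (F2^ n → F2^ n → Bool) → Set
DistCCGreaterThan1 {n} μ F =
  (t : ℕ) → t ≤ 1 → (M : F2^ n → Vec Bool t) → (h : Vec Bool t → F2^ n → Bool) →
  200 * correctW μ F M h < 199 * total μ

-- D^{→}_{1/200}(F) = sup_μ D^{→,μ}_{1/200}(F) > 1 : some distribution μ
-- has D^{→,μ}_{1/200}(F) > 1.
OneWayCCGreaterThan1 : ∀ {n} → (F2^ n → F2^ n → Bool) → Set
OneWayCCGreaterThan1 {n} F = Σ (Dist n) λ μ → (0 < total μ) × DistCCGreaterThan1 μ F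

module Submission where

-- Let ε = χ_S + f be the error set of a closest character, of density ≤ 1/10, and x₀ ∈ ε
-- (f is non-linear).  Rows u, u′ of f⁺ differ somewhere as soon as f is not invariant under
-- translation by d = u + u′, and this holds whenever x₀ + d ∉ ε: if χ_S(d) = 0 the
-- translation moves the error x₀ to a non-error, and if χ_S(d) = 1 it flips f at every z
-- with z, z + d ∉ ε, and such z exists because |ε| < 2ⁿ/2.  The same union bound yields
-- x₁, x₂ with x₁, x₂, x₀ + x₁ + x₂ ∉ ε, so the rows x₀, x₁, x₂ are pairwise separated by
-- some columns yᵢⱼ.  On the uniform distribution over the six pairs (xᵢ, yᵢⱼ), (xⱼ, yᵢⱼ),
-- a one-bit message agrees on two of the xᵢ, so some answer is wrong: error ≥ 1/6 > 1/200.

open import Defs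
open import Algebra.Bundles using (CommutativeRing)
open import Data.Bool using (Bool; true; false; _xor_; _∧_)
open import Data.Bool.Properties
  using (xor-assoc; xor-comm; xor-same; xor-inverseʳ; ∧-distribˡ-xor; ¬-not; xor-∧-commutativeRing)
  renaming (_≟_ to _≟ᴮ_)
open import Data.List using (List; []; _∷_; map; concatMap; _++_; length)
open import Data.List.Properties using (map-++; map-cong; map-∘)
open import Data.Nat using (ℕ; zero; suc; _+_; _*_; _^_; _≤_; _<_; z≤n; s≤s; _<?_)
open import Data.Nat.ListAction using (sum)
open import Data.Nat.ListAction.Properties using (sum-++)
open import Data.Nat.Properties
open import Data.Product using (∃; _×_; _,_; proj₁; proj₂; uncurry)
open import Data.Sum using (_⊎_; inj₁; inj₂) renaming (map to ⊎-map)
open import Data.Vec using (Vec; []; _∷_)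
open import Data.Vec.Properties using (zipWith-assoc; zipWith-comm; ≡-dec)
open import Relation.Binary.PropositionalEquality
  using (_≡_; _≢_; refl; sym; trans; cong; cong₂; subst; subst₂; ≢-sym; module ≡-Reasoning)
open import Relation.Nullary using (yes; no; does; contradiction)
open import Algebra.Properties.CommutativeSemigroup +-commutativeSemigroup
  using () renaming (interchange to +-interchange)
open import Algebra.Properties.CommutativeSemigroup
  (CommutativeRing.+-commutativeSemigroup xor-∧-commutativeRing)
  using () renaming (interchange to xor-interchange)

open ≡-Reasoning

xor-cancelˡ : ∀ a b → a xor (a xor b) ≡ b
xor-cancelˡ a b = trans (sym (xor-assoc a a b)) (cong (_xor b) (xor-same a))

≢⇒xor≡true : ∀ {a b} → a ≢ b → a xor b ≡ true
≢⇒xor≡true {a} a≢b = trans (cong (a xor_) (¬-not (≢-sym a≢b))) (xor-inverseʳ a)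

xor≡true⇒≢ : ∀ {a b} → a xor b ≡ true → a ≢ b
xor≡true⇒≢ {true}  () refl
xor≡true⇒≢ {false} () refl

[]≤1 : ∀ b → [ b ] ≤ 1
[]≤1 true  = s≤s z≤n
[]≤1 false = z≤n

[]+[]<1⇒false : ∀ {a b} → [ a ] + [ b ] < 1 → a ≡ false × b ≡ false
[]+[]<1⇒false {false} {false} _ = refl , refl
[]+[]<1⇒false {false} {true}  (s≤s ())
[]+[]<1⇒false {true}          (s≤s ())

[eqB]+[xor]≡1 : ∀ a b → [ eqB a b ] + [ a xor b ] ≡ 1
[eqB]+[xor]≡1 false false = refl
[eqB]+[xor]≡1 false true  = refl
[eqB]+[xor]≡1 true  false = refl
[eqB]+[xor]≡1 true  true  = refl

[eqB]+[eqB]≡1 : ∀ r {a b} → a ≢ b → [ eqB r a ] + [ eqB r b ] ≡ 1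
[eqB]+[eqB]≡1 false {false} {true}  _ = refl
[eqB]+[eqB]≡1 false {true}  {false} _ = refl
[eqB]+[eqB]≡1 true  {false} {true}  _ = refl
[eqB]+[eqB]≡1 true  {true}  {false} _ = refl
[eqB]+[eqB]≡1 _     {false} {false} a≢b = contradiction refl a≢b
[eqB]+[eqB]≡1 _     {true}  {true}  a≢b = contradiction refl a≢b

⊕-assoc : ∀ {n} (u v z : F2^ n) → (u ⊕ v) ⊕ z ≡ u ⊕ (v ⊕ z)
⊕-assoc = zipWith-assoc xor-assoc

⊕-comm : ∀ {n} (u v : F2^ n) → u ⊕ v ≡ v ⊕ u
⊕-comm = zipWith-comm xor-comm

⊕-cancelˡ : ∀ {n} (u z : F2^ n) → u ⊕ (u ⊕ z) ≡ z
⊕-cancelˡ []      []      = refl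
⊕-cancelˡ (a ∷ u) (b ∷ z) = cong₂ _∷_ (xor-cancelˡ a b) (⊕-cancelˡ u z)

χ-⊕ : ∀ {n} (S u v : F2^ n) → χ S (u ⊕ v) ≡ χ S u xor χ S v
χ-⊕ []      []      []      = refl
χ-⊕ (s ∷ S) (a ∷ u) (b ∷ v) = begin
  (s ∧ (a xor b)) xor χ S (u ⊕ v)                 ≡⟨ cong₂ _xor_ (∧-distribˡ-xor s a b) (χ-⊕ S u v) ⟩
  ((s ∧ a) xor (s ∧ b)) xor (χ S u xor χ S v)     ≡⟨ xor-interchange (s ∧ a) (s ∧ b) (χ S u) (χ S v) ⟩
  ((s ∧ a) xor χ S u) xor ((s ∧ b) xor χ S v)     ∎

-- Sums over F₂ⁿ

∑ : (n : ℕ) → (F2^ n → ℕ) → ℕ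
∑ zero    h = h []
∑ (suc n) h = ∑ n (λ v → h (false ∷ v) + h (true ∷ v))

∑-cong : ∀ n {h k : F2^ n → ℕ} → (∀ z → h z ≡ k z) → ∑ n h ≡ ∑ n k
∑-cong zero    h≗k = h≗k []
∑-cong (suc n) h≗k = ∑-cong n (λ v → cong₂ _+_ (h≗k (false ∷ v)) (h≗k (true ∷ v)))

∑-+ : ∀ n (h k : F2^ n → ℕ) → ∑ n (λ z → h z + k z) ≡ ∑ n h + ∑ n k
∑-+ zero    h k = refl
∑-+ (suc n) h k = trans
  (∑-cong n (λ v → +-interchange (h (false ∷ v)) (k (false ∷ v)) (h (true ∷ v)) (k (true ∷ v))))
  (∑-+ n _ _)

∑-zero : ∀ n → ∑ n (λ _ → 0) ≡ 0
∑-zero zero    = refl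
∑-zero (suc n) = ∑-zero n

∑-* : ∀ n c (h : F2^ n → ℕ) → ∑ n (λ z → c * h z) ≡ c * ∑ n h
∑-* zero    c h = refl
∑-* (suc n) c h = trans
  (∑-cong n (λ v → sym (*-distribˡ-+ c (h (false ∷ v)) (h (true ∷ v)))))
  (∑-* n c _)

∑-1 : ∀ n → ∑ n (λ _ → 1) ≡ 2 ^ n
∑-1 zero    = refl
∑-1 (suc n) = trans (∑-* n 2 (λ _ → 1)) (cong (2 *_) (∑-1 n))

∑-translate : ∀ n (u : F2^ n) (h : F2^ n → ℕ) → ∑ n (λ z → h (u ⊕ z)) ≡ ∑ n h
∑-translate zero    []          h = refl
∑-translate (suc n) (false ∷ u) h = ∑-translate n u (λ v → h (false ∷ v) + h (true ∷ v))
∑-translate (suc n) (true ∷ u)  h = trans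
  (∑-cong n (λ v → +-comm (h (true ∷ (u ⊕ v))) (h (false ∷ (u ⊕ v)))))
  (∑-translate n u (λ v → h (false ∷ v) + h (true ∷ v)))

∑-<⇒∃< : ∀ n (h k : F2^ n → ℕ) → ∑ n h < ∑ n k → ∃ λ z → h z < k z
∑-<⇒∃< zero    h k lt = [] , lt
∑-<⇒∃< (suc n) h k lt with ∑-<⇒∃< n _ _ lt
... | v , lt′ with h (false ∷ v) <? k (false ∷ v)
...   | yes lt₀ = false ∷ v , lt₀
...   | no  ≮₀  = true ∷ v , +-cancelˡ-< (h (false ∷ v)) _ _
                    (<-≤-trans lt′ (+-monoˡ-≤ (k (true ∷ v)) (≮⇒≥ ≮₀)))

δ : ∀ {n} → F2^ n → F2^ n → ℕ
δ u v = [ does (≡-dec _≟ᴮ_ u v) ]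

∑-δ : ∀ n (z₀ : F2^ n) (h : F2^ n → ℕ) → ∑ n (λ z → δ z z₀ * h z) ≡ h z₀
∑-δ zero    []           h = +-identityʳ (h [])
∑-δ (suc n) (false ∷ z₀) h = trans (∑-cong n (λ v → +-identityʳ _)) (∑-δ n z₀ (λ v → h (false ∷ v)))
∑-δ (suc n) (true ∷ z₀)  h = ∑-δ n z₀ (λ v → h (true ∷ v))

sum-map-concatMap : ∀ {A B : Set} (h : B → ℕ) (g : A → List B) xs →
  sum (map h (concatMap g xs)) ≡ sum (map (λ x → sum (map h (g x))) xs)
sum-map-concatMap h g []       = refl
sum-map-concatMap h g (x ∷ xs) = begin
  sum (map h (g x ++ concatMap g xs))            ≡⟨ cong sum (map-++ h (g x) (concatMap g xs)) ⟩
  sum (map h (g x) ++ map h (concatMap g xs))    ≡⟨ sum-++ (map h (g x)) _ ⟩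
  sum (map h (g x)) + sum (map h (concatMap g xs)) ≡⟨ cong (sum (map h (g x)) +_) (sum-map-concatMap h g xs) ⟩
  sum (map h (g x)) + sum (map (λ x → sum (map h (g x))) xs) ∎

sum-allVecs : ∀ n (h : F2^ n → ℕ) → sum (map h (allVecs n)) ≡ ∑ n h
sum-allVecs zero    h = +-identityʳ (h [])
sum-allVecs (suc n) h = begin
  sum (map h (allVecs (suc n)))                                   ≡⟨ sum-map-concatMap h _ (allVecs n) ⟩
  sum (map (λ v → h (false ∷ v) + (h (true ∷ v) + 0)) (allVecs n)) ≡⟨ cong sum (map-cong (λ v → cong (h (false ∷ v) +_) (+-identityʳ _)) (allVecs n)) ⟩
  sum (map (λ v → h (false ∷ v) + h (true ∷ v)) (allVecs n))       ≡⟨ sum-allVecs n _ ⟩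
  ∑ (suc n) h                                                     ∎

sum-allPairs : ∀ n (h : F2^ n × F2^ n → ℕ) → sum (map h (allPairs n)) ≡ ∑ n (λ x → ∑ n (λ y → h (x , y)))
sum-allPairs n h = begin
  sum (map h (allPairs n))                                          ≡⟨ sum-map-concatMap h _ (allVecs n) ⟩
  sum (map (λ x → sum (map h (map (x ,_) (allVecs n)))) (allVecs n)) ≡⟨ cong sum (map-cong inner (allVecs n)) ⟩
  sum (map (λ x → ∑ n (λ y → h (x , y))) (allVecs n))               ≡⟨ sum-allVecs n _ ⟩
  ∑ n (λ x → ∑ n (λ y → h (x , y)))                                 ∎
  where
  inner : ∀ x → sum (map h (map (x ,_) (allVecs n))) ≡ ∑ n (λ y → h (x , y))
  inner x = trans (cong sum (sym (map-∘ (allVecs n)))) (sum-allVecs n _)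

count : ∀ {n} → (F2^ n → Bool) → ℕ
count {n} e = ∑ n (λ z → [ e z ])

two-common-zeros : ∀ {n} (e : F2^ n → Bool) → count e + count e < 2 ^ n →
                   ∀ c → ∃ λ y → e y ≡ false × e (c ⊕ y) ≡ false
two-common-zeros {n} e rare c = y , []+[]<1⇒false lt₁
  where
  lt : ∑ n (λ y → [ e y ] + [ e (c ⊕ y) ]) < ∑ n (λ _ → 1)
  lt = subst₂ _<_
    (sym (trans (∑-+ n _ _) (cong (count e +_) (∑-translate n c (λ z → [ e z ])))))
    (sym (∑-1 n))
    rare
  y : F2^ n
  y = proj₁ (∑-<⇒∃< n _ _ lt)
  lt₁ : [ e y ] + [ e (c ⊕ y) ] < 1
  lt₁ = proj₂ (∑-<⇒∃< n _ _ lt)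

few-errors⇒twice<total : ∀ {A B N} → A + B ≡ N → 9 * N ≤ 10 * A → 0 < N → B + B < N
few-errors⇒twice<total {A} {B} {N} A+B≡N far N>0 = twice<tenfold B 10B≤N
  where
  10B≤N : 10 * B ≤ N
  10B≤N = +-cancelˡ-≤ (9 * N) _ _ (≤-trans (+-monoˡ-≤ (10 * B) far) (≤-reflexive (begin
    10 * A + 10 * B  ≡⟨ sym (*-distribˡ-+ 10 A B) ⟩
    10 * (A + B)     ≡⟨ cong (10 *_) A+B≡N ⟩
    10 * N           ≡⟨ +-comm N (9 * N) ⟩
    9 * N + N        ∎)))
  twice<tenfold : ∀ b → 10 * b ≤ N → b + b < N
  twice<tenfold zero    _ = N>0
  twice<tenfold (suc b) l = <-≤-trans
    (subst (_< 10 * suc b) (cong (suc b +_) (+-identityʳ (suc b))) (*-monoˡ-< (suc b) {2} {10} (<ᵇ⇒< 2 10 _)))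
    l

-- One-way protocols

Separated : ∀ {n} → (F2^ n → F2^ n → Bool) → F2^ n → F2^ n → Set
Separated F x x′ = ∃ λ y → F x y ≢ F x′ y

uniformOn : ∀ {n} → List (F2^ n × F2^ n) → Dist n
uniformOn L = record { w = λ x y → sum (map (λ p → δ x (proj₁ p) * δ y (proj₂ p)) L) }

∑∑-uniformOn : ∀ {n} (L : List (F2^ n × F2^ n)) (c : F2^ n → F2^ n → ℕ) →
  ∑ n (λ x → ∑ n (λ y → w (uniformOn L) x y * c x y)) ≡ sum (map (uncurry c) L)
∑∑-uniformOn {n} [] c = trans (∑-cong n (λ _ → ∑-zero n)) (∑-zero n)
∑∑-uniformOn {n} ((x₀ , y₀) ∷ L) c = begin
  ∑ n (λ x → ∑ n (λ y → (δ x x₀ * δ y y₀ + wL x y) * c x y))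
    ≡⟨ ∑-cong n (λ x → trans (∑-cong n (λ y → *-distribʳ-+ (c x y) (δ x x₀ * δ y y₀) (wL x y))) (∑-+ n _ _)) ⟩
  ∑ n (λ x → ∑ n (λ y → δ x x₀ * δ y y₀ * c x y) + ∑ n (λ y → wL x y * c x y))
    ≡⟨ ∑-+ n _ _ ⟩
  ∑ n (λ x → ∑ n (λ y → δ x x₀ * δ y y₀ * c x y)) + ∑ n (λ x → ∑ n (λ y → wL x y * c x y))
    ≡⟨ cong₂ _+_ point (∑∑-uniformOn L c) ⟩
  c x₀ y₀ + sum (map (uncurry c) L) ∎
  where
  wL : F2^ n → F2^ n → ℕ
  wL = w (uniformOn L)
  point : ∑ n (λ x → ∑ n (λ y → δ x x₀ * δ y y₀ * c x y)) ≡ c x₀ y₀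
  point = trans
    (∑-cong n (λ x → trans (∑-cong n (λ y → *-assoc (δ x x₀) (δ y y₀) (c x y)))
                   (trans (∑-* n (δ x x₀) _) (cong (δ x x₀ *_) (∑-δ n y₀ (c x))))))
    (∑-δ n x₀ (λ x → c x y₀))

total-uniformOn : ∀ {n} (L : List (F2^ n × F2^ n)) → total (uniformOn L) ≡ length L
total-uniformOn {n} L = begin
  total (uniformOn L)                                        ≡⟨ sum-allPairs n _ ⟩
  ∑ n (λ x → ∑ n (λ y → w (uniformOn L) x y))                ≡⟨ ∑-cong n (λ x → ∑-cong n (λ y → sym (*-identityʳ _))) ⟩
  ∑ n (λ x → ∑ n (λ y → w (uniformOn L) x y * 1))            ≡⟨ ∑∑-uniformOn L (λ _ _ → 1) ⟩
  sum (map (λ _ → 1) L)                                      ≡⟨ sum-ones L ⟩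
  length L                                                   ∎
  where
  sum-ones : ∀ (xs : List (F2^ n × F2^ n)) → sum (map (λ _ → 1) xs) ≡ length xs
  sum-ones []       = refl
  sum-ones (_ ∷ xs) = cong suc (sum-ones xs)

correctAt : ∀ {n t} → (F2^ n → F2^ n → Bool) → (F2^ n → Vec Bool t) → (Vec Bool t → F2^ n → Bool) →
            F2^ n → F2^ n → ℕ
correctAt F M h x y = [ eqB (h (M x) y) (F x y) ]

correctW-uniformOn : ∀ {n t} (L : List (F2^ n × F2^ n)) F (M : F2^ n → Vec Bool t) h →
  correctW (uniformOn L) F M h ≡ sum (map (uncurry (correctAt F M h)) L)
correctW-uniformOn {n} L F M h = trans (sum-allPairs n _) (∑∑-uniformOn L (correctAt F M h))

collision-costs : ∀ {n t} F (M : F2^ n → Vec Bool t) h {x x′ y} → M x ≡ M x′ → F x y ≢ F x′ y →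
                  correctAt F M h x y + correctAt F M h x′ y ≤ 1
collision-costs F M h {x} {x′} {y} Mx≡Mx′ Fx≢Fx′ = ≤-reflexive (begin
  [ eqB (h (M x) y) (F x y) ] + [ eqB (h (M x′) y) (F x′ y) ]
    ≡⟨ cong (λ m → [ eqB (h m y) (F x y) ] + [ eqB (h (M x′) y) (F x′ y) ]) Mx≡Mx′ ⟩
  [ eqB (h (M x′) y) (F x y) ] + [ eqB (h (M x′) y) (F x′ y) ]
    ≡⟨ [eqB]+[eqB]≡1 (h (M x′) y) Fx≢Fx′ ⟩
  1 ∎)

bool-pigeonhole : (a b c : Bool) → a ≡ b ⊎ a ≡ c ⊎ b ≡ c
bool-pigeonhole false false _     = inj₁ refl
bool-pigeonhole true  true  _     = inj₁ refl
bool-pigeonhole false true  false = inj₂ (inj₁ refl)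
bool-pigeonhole true  false true  = inj₂ (inj₁ refl)
bool-pigeonhole false true  true  = inj₂ (inj₂ refl)
bool-pigeonhole true  false false = inj₂ (inj₂ refl)

messages-collide : ∀ {t} → t ≤ 1 → (m₁ m₂ m₃ : Vec Bool t) → m₁ ≡ m₂ ⊎ m₁ ≡ m₃ ⊎ m₂ ≡ m₃
messages-collide z≤n       []        []        []        = inj₁ refl
messages-collide (s≤s z≤n) (a ∷ []) (b ∷ []) (c ∷ []) =
  ⊎-map (cong (_∷ [])) (⊎-map (cong (_∷ [])) (cong (_∷ []))) (bool-pigeonhole a b c)

three-pairs≤5 : ∀ {a b c} → a ≤ 2 → b ≤ 2 → c ≤ 2 → a ≤ 1 ⊎ b ≤ 1 ⊎ c ≤ 1 → a + (b + c) ≤ 5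
three-pairs≤5 a≤2 b≤2 c≤2 (inj₁ a≤1)        = +-mono-≤ a≤1 (+-mono-≤ b≤2 c≤2)
three-pairs≤5 a≤2 b≤2 c≤2 (inj₂ (inj₁ b≤1)) = +-mono-≤ a≤2 (+-mono-≤ b≤1 c≤2)
three-pairs≤5 a≤2 b≤2 c≤2 (inj₂ (inj₂ c≤1)) = +-mono-≤ a≤2 (+-mono-≤ b≤2 c≤1)

separated-triple⇒CC>1 : ∀ {n} {F : F2^ n → F2^ n → Bool} {x₁ x₂ x₃} →
  Separated F x₁ x₂ → Separated F x₁ x₃ → Separated F x₂ x₃ → OneWayCCGreaterThan1 F
separated-triple⇒CC>1 {n} {F} {x₁} {x₂} {x₃} (y₁₂ , F₁₂) (y₁₃ , F₁₃) (y₂₃ , F₂₃) =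
  uniformOn L , subst (0 <_) (sym (total-uniformOn L)) (s≤s z≤n) , one-bit-fails
  where
  L : List (F2^ n × F2^ n)
  L = (x₁ , y₁₂) ∷ (x₂ , y₁₂) ∷ (x₁ , y₁₃) ∷ (x₃ , y₁₃) ∷ (x₂ , y₂₃) ∷ (x₃ , y₂₃) ∷ []

  one-bit-fails : DistCCGreaterThan1 (uniformOn L) F
  one-bit-fails t t≤1 M h = subst₂ (λ c T → 200 * c < 199 * T)
    (sym (correctW-uniformOn L F M h)) (sym (total-uniformOn L))
    (≤-<-trans (*-monoʳ-≤ 200 correct≤5) (<ᵇ⇒< 1000 1194 _))
    where
    c : F2^ n → F2^ n → ℕ
    c = correctAt F M h

    pair : F2^ n → F2^ n → F2^ n → ℕ
    pair x x′ y = c x y + c x′ y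

    pair≤2 : ∀ x x′ y → pair x x′ y ≤ 2
    pair≤2 x x′ y = +-mono-≤ ([]≤1 (eqB (h (M x) y) (F x y))) ([]≤1 (eqB (h (M x′) y) (F x′ y)))

    some-pair≤1 : pair x₁ x₂ y₁₂ ≤ 1 ⊎ pair x₁ x₃ y₁₃ ≤ 1 ⊎ pair x₂ x₃ y₂₃ ≤ 1
    some-pair≤1 = ⊎-map (λ e → collision-costs F M h e F₁₂)
                   (⊎-map (λ e → collision-costs F M h e F₁₃) (λ e → collision-costs F M h e F₂₃))
                   (messages-collide t≤1 (M x₁) (M x₂) (M x₃))

    correct≤5 : sum (map (uncurry c) L) ≤ 5
    correct≤5 = subst (_≤ 5) (sym (regroup (c x₁ y₁₂) (c x₂ y₁₂) (c x₁ y₁₃) (c x₃ y₁₃) (c x₂ y₂₃) (c x₃ y₂₃)))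
      (three-pairs≤5 (pair≤2 x₁ x₂ y₁₂) (pair≤2 x₁ x₃ y₁₃) (pair≤2 x₂ x₃ y₂₃) some-pair≤1)
      where
      regroup : ∀ a₁ a₂ a₃ a₄ a₅ a₆ →
                a₁ + (a₂ + (a₃ + (a₄ + (a₅ + (a₆ + 0))))) ≡ (a₁ + a₂) + ((a₃ + a₄) + (a₅ + a₆))
      regroup a₁ a₂ a₃ a₄ a₅ a₆ = begin
        a₁ + (a₂ + (a₃ + (a₄ + (a₅ + (a₆ + 0)))))    ≡⟨ sym (+-assoc a₁ a₂ _) ⟩
        (a₁ + a₂) + (a₃ + (a₄ + (a₅ + (a₆ + 0))))    ≡⟨ cong ((a₁ + a₂) +_) (sym (+-assoc a₃ a₄ _)) ⟩
        (a₁ + a₂) + ((a₃ + a₄) + (a₅ + (a₆ + 0)))    ≡⟨ cong (λ z → (a₁ + a₂) + ((a₃ + a₄) + (a₅ + z))) (+-identityʳ a₆) ⟩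
        (a₁ + a₂) + ((a₃ + a₄) + (a₅ + a₆))          ∎

-- Translations and errors of f

non-period⇒separated : ∀ {n} (f : F2^ n → Bool) {u u′ : F2^ n} →
                  (∃ λ z → f z ≢ f (z ⊕ (u ⊕ u′))) → Separated (f ⁺) u u′
non-period⇒separated f {u} {u′} (z , fz≢) = u ⊕ z , λ eq → fz≢ (begin
  f z                 ≡⟨ cong f (sym (⊕-cancelˡ u z)) ⟩
  f (u ⊕ (u ⊕ z))     ≡⟨ eq ⟩
  f (u′ ⊕ (u ⊕ z))    ≡⟨ cong f shift ⟩
  f (z ⊕ (u ⊕ u′))    ∎)
  where
  shift : u′ ⊕ (u ⊕ z) ≡ z ⊕ (u ⊕ u′)
  shift = begin
    u′ ⊕ (u ⊕ z)  ≡⟨ sym (⊕-assoc u′ u z) ⟩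
    (u′ ⊕ u) ⊕ z  ≡⟨ cong (_⊕ z) (⊕-comm u′ u) ⟩
    (u ⊕ u′) ⊕ z  ≡⟨ ⊕-comm (u ⊕ u′) z ⟩
    z ⊕ (u ⊕ u′)  ∎

module Errors {n} (f : F2^ n → Bool) (S : F2^ n) where

  ε : F2^ n → Bool
  ε z = χ S z xor f z

  agree+errors : agree f S + count ε ≡ 2 ^ n
  agree+errors = begin
    agree f S + count ε                                    ≡⟨ cong (_+ count ε) (sum-allVecs n _) ⟩
    ∑ n (λ z → [ eqB (χ S z) (f z) ]) + count ε            ≡⟨ sym (∑-+ n _ _) ⟩
    ∑ n (λ z → [ eqB (χ S z) (f z) ] + [ ε z ])            ≡⟨ ∑-cong n (λ z → [eqB]+[xor]≡1 (χ S z) (f z)) ⟩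
    ∑ n (λ _ → 1)                                          ≡⟨ ∑-1 n ⟩
    2 ^ n                                                  ∎

  f-xor-shift : ∀ d z → f z xor f (z ⊕ d) ≡ χ S d xor (ε z xor ε (z ⊕ d))
  f-xor-shift d z = begin
    f z xor f (z ⊕ d)
      ≡⟨ sym (xor-cancelˡ (χ S d) _) ⟩
    χ S d xor (χ S d xor (f z xor f (z ⊕ d)))
      ≡⟨ cong (λ c → χ S d xor (c xor (f z xor f (z ⊕ d)))) (sym χ-shift) ⟩
    χ S d xor ((χ S z xor χ S (z ⊕ d)) xor (f z xor f (z ⊕ d)))
      ≡⟨ cong (χ S d xor_) (xor-interchange (χ S z) (χ S (z ⊕ d)) (f z) (f (z ⊕ d))) ⟩
    χ S d xor (ε z xor ε (z ⊕ d)) ∎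
    where
    χ-shift : χ S z xor χ S (z ⊕ d) ≡ χ S d
    χ-shift = trans (cong (χ S z xor_) (χ-⊕ S z d)) (xor-cancelˡ (χ S z) (χ S d))

  non-period : ∀ {x₀} → ε x₀ ≡ true → (∀ c → ∃ λ y → ε y ≡ false × ε (c ⊕ y) ≡ false) →
               ∀ d → ε (x₀ ⊕ d) ≡ false → ∃ λ z → f z ≢ f (z ⊕ d)
  non-period {x₀} εx₀ common-zeros d εx₀d with χ S d in χd
  ... | false = x₀ , xor≡true⇒≢ (trans (f-xor-shift d x₀) (cong₂ _xor_ χd (cong₂ _xor_ εx₀ εx₀d)))
  ... | true with common-zeros d
  ...   | z , εz , εdz = z , xor≡true⇒≢
          (trans (f-xor-shift d z) (cong₂ _xor_ χd (cong₂ _xor_ εz (trans (cong ε (⊕-comm z d)) εdz))))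

theorem7p1 : (n : ℕ) (f : F2^ n → Bool) → NonLinear f → AtMostTenthFar f →
    OneWayCCGreaterThan1 (f ⁺)
theorem7p1 n f nonlinear (S , far) =
  separated-triple⇒CC>1
    (separated x₀ x₁ (trans (cong ε (⊕-cancelˡ x₀ x₁)) εx₁))
    (separated x₀ x₂ (trans (cong ε (⊕-cancelˡ x₀ x₂)) εx₂))
    (separated x₁ x₂ (trans (cong ε (sym (⊕-assoc x₀ x₁ x₂))) εx₀x₁x₂))
  where
  open Errors f S

  common-zeros : ∀ c → ∃ λ y → ε y ≡ false × ε (c ⊕ y) ≡ false
  common-zeros = two-common-zeros ε (few-errors⇒twice<total {agree f S} agree+errors far (m^n>0 2 n))

  x₀ : F2^ n
  x₀ = proj₁ (nonlinear S)

  εx₀ : ε x₀ ≡ true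
  εx₀ = ≢⇒xor≡true (≢-sym (proj₂ (nonlinear S)))

  x₁ x₂ : F2^ n
  x₁ = proj₁ (common-zeros x₀)
  x₂ = proj₁ (common-zeros (x₀ ⊕ x₁))

  εx₁ : ε x₁ ≡ false
  εx₁ = proj₁ (proj₂ (common-zeros x₀))

  εx₂ : ε x₂ ≡ false
  εx₂ = proj₁ (proj₂ (common-zeros (x₀ ⊕ x₁)))

  εx₀x₁x₂ : ε ((x₀ ⊕ x₁) ⊕ x₂) ≡ false
  εx₀x₁x₂ = proj₂ (proj₂ (common-zeros (x₀ ⊕ x₁)))

  separated : ∀ u u′ → ε (x₀ ⊕ (u ⊕ u′)) ≡ false → Separated (f ⁺) u u′
  separated u u′ e = non-period⇒separated f (non-period εx₀ common-zeros (u ⊕ u′) e)
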